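{- Let $n$ be a positive integer and let $j$ be an integer with $0\le j\le n$. Then \[ \mathrm{Sym}_{W_n}\big(x_0^2x_1^2\cdots x_{n-j}^2\,x_{n-j+1}\cdots x_n\big)=x_0^2\sum_{k=0}^{n-j}\mathfrak{S}^{(n)}_{k,j}. \]
   Context: $W_n$ is the group of $\mathbb{Q}$-automorphisms of $\mathbb{Q}(x_0,x_1^{\pm1},\dots,x_n^{\pm1})$ generated by the permutations of $x_1,\dots,x_n$ (fixing $x_0$) and, for $1\le i\le n$, the maps $\tau_i$ with $\tau_i(x_0)=x_0x_i$, $\tau_i(x_i)=x_i^{ -1}$, $\tau_i(x_j)=x_j$ ($j\neq i,0$). For a polynomial $f$, $\mathrm{Sym}_{W_n}(f)=\sum_{\sigma\in W_n/\mathrm{Stab}(f)}\sigma(f)$, i.e. the sum of the distinct elements of the $W_n$-orbit of $f$; similarly for $f\in\mathbb{Q}[x_1,\dots,x_n]$, $\mathrm{Sym}_{S_n}(f)=\sum_{\sigma\in S_n/\mathrm{Stab}(f)}\sigma(f)$, where $S_n$ permutes the subscripts of $x_1,\dots,x_n$. For integers $k,j\ge 0$ with $k+j\le n$, $\mathfrak{S}^{(n)}_{k,j}=\mathrm{Sym}_{S_n}(x_1^2\cdots x_k^2\,x_{k+1}\cdots x_{k+j})$ (the sum of all distinct monomials in $x_1,\dots,x_n$ in which exactly $k$ variables appear squared, exactly $j$ variables appear to the first power, and the rest do not appear). -}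

module Defs where

open import Data.Nat as ℕ using (ℕ; zero; suc; _∸_; _<ᵇ_; _≡ᵇ_)
open import Data.Bool using (Bool; true; false; if_then_else_; _∧_)
open import Data.Integer as ℤ using (ℤ; +_; _-_)
open import Data.Fin using (Fin; toℕ; _≟_)
open import Data.Product using (_×_; _,_; Σ)
open import Data.Vec using (Vec; []; _∷_; lookup; tabulate; map)
open import Data.List as List using (List; []; _∷_; [_]; concatMap; filterᵇ; upTo)
open import Data.List.Relation.Unary.Unique.Propositional using (Unique)
open import Data.List.Membership.Propositional using (_∈_)
open import Data.Fin.Permutation using (Permutation′; _⟨$⟩ˡ_)
open import Relation.Nullary using (does)
open import Function.Bundles using (_⇔_)

-- A Laurent monomial x₀^a · x₁^{e₁} ⋯ xₙ^{eₙ}, encoded as (a , (e₁,…,eₙ));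
-- position i : Fin n of the vector is the exponent of x_{toℕ i + 1}.
Mono : ℕ → Set
Mono n = ℤ × Vec ℤ n

-- A "polynomial" that is a sum of monomials each with coefficient 1 is
-- represented by the list of its monomials (with multiplicity); two such
-- sums are equal as polynomials iff the lists are permutations of each other.

-- Action of the generators of W_n on monomials.
-- Permutation σ of x₁..xₙ : x_i ↦ x_{σ(i)}, so the new exponent of x_{σ(i)} is e_i.
permAct : ∀ {n} → Permutation′ n → Mono n → Mono n
permAct σ (a , e) = a , tabulate (λ i → lookup e (σ ⟨$⟩ˡ i))

-- τ_i : x₀ ↦ x₀ x_i , x_i ↦ x_i⁻¹ , x_j ↦ x_j.
-- So x₀^a ∏ x_j^{e_j} ↦ x₀^a x_i^{a - e_i} ∏_{j≠i} x_j^{e_j}.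
tauAct : ∀ {n} → Fin n → Mono n → Mono n
tauAct i (a , e) = a , tabulate (λ j → if does (j ≟ i) then a - lookup e j else lookup e j)

data Step {n : ℕ} : Mono n → Mono n → Set where
  perm : (σ : Permutation′ n) (m : Mono n) → Step m (permAct σ m)
  tau  : (i : Fin n) (m : Mono n) → Step m (tauAct i m)

-- The W_n-orbit of a monomial: reflexive-transitive closure of generator
-- steps (the generating set is closed under inverses and W_n is generated
-- by it, so this is exactly the orbit).
data InOrbit {n : ℕ} (f : Mono n) : Mono n → Set where
  here : InOrbit f f
  next : ∀ {m m'} → InOrbit f m → Step m m' → InOrbit f m'

-- L is a list of the distinct elements of the W_n-orbit of the monomial f,
-- so that (the sum of) L is Sym_{W_n}(f).
IsSymW : ∀ {n} → Mono n → List (Mono n) → Set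
IsSymW f L = Unique L × (∀ m → (m ∈ L) ⇔ InOrbit f m)

startMono : (n j : ℕ) → Mono n
startMono n j = + 2 , tabulate (λ i → if toℕ i <ᵇ (n ∸ j) then + 2 else + 1)

allVecs012 : (n : ℕ) → List (Vec ℕ n)
allVecs012 zero = [ [] ]
allVecs012 (suc n) = concatMap (λ v → List.map (_∷ v) (0 ∷ 1 ∷ 2 ∷ [])) (allVecs012 n)

countVal : ∀ {n} → ℕ → Vec ℕ n → ℕ
countVal c [] = 0
countVal c (x ∷ xs) = (if x ≡ᵇ c then 1 else 0) ℕ.+ countVal c xs

frakS : (n k j : ℕ) → List (Vec ℤ n)
frakS n k j = List.map (map +_)
  (filterᵇ (λ e → (countVal 2 e ≡ᵇ k) ∧ (countVal 1 e ≡ᵇ j)) (allVecs012 n))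

rhs : (n j : ℕ) → List (Mono n)
rhs n j = concatMap (λ k → List.map (λ e → (+ 2 , e)) (frakS n k j)) (upTo (suc (n ∸ j)))

-- Each generator of W_n maps a monomial x₀²·x^e with e ∈ {0,1,2}ⁿ to another
-- such monomial with the same number of exponents equal to 1: a permutation
-- permutes e, and τᵢ replaces eᵢ by 2 − eᵢ.  Conversely, every such monomial
-- with j ones is reached from x₀²x₁²⋯x_{n−j}²x_{n−j+1}⋯xₙ: τᵢ turns a square
-- into an absent variable, and adjacent transpositions move the ones into
-- place.  So the orbit consists exactly of these monomials, and the right-hand
-- side lists each of them once, grouped by the number k of squares.
module Submission where

open import Defs
open import Data.Bool using (Bool; true; false; if_then_else_; T; _∧_)
open import Data.Bool.Properties using (T-∧; if-float)
open import Data.Fin using (Fin; toℕ; _≟_) renaming (zero to fzero; suc to fsuc)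
open import Data.Fin.Permutation using (Permutation′; _⟨$⟩ˡ_; _⟨$⟩ʳ_; inverseˡ; transpose; lift₀)
open import Data.Integer using (ℤ; +_; _-_)
open import Data.Integer.Properties using (m-n≡m⊖n; ⊖-≥; +-injective)
open import Data.List as List using (List; []; _∷_; concatMap; upTo)
open import Data.List.Membership.Propositional using (_∈_; find)
open import Data.List.Membership.Propositional.Properties
  using (∈-map⁺; ∈-map⁻; ∈-concatMap⁺; ∈-concatMap⁻; ∈-filter⁺; ∈-filter⁻; ∈-upTo⁺)
open import Data.List.Membership.Propositional.Properties.WithK using (unique∧set⇒bag)
open import Data.List.Relation.Binary.BagAndSetEquality using (∼bag⇒↭)
open import Data.List.Relation.Binary.Permutation.Propositional using (_↭_)
open import Data.List.Relation.Unary.All as ListAll using ()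
open import Data.List.Relation.Unary.All.Properties as ListAllₚ using ()
open import Data.List.Relation.Unary.AllPairs as AllPairs using ()
open import Data.List.Relation.Unary.AllPairs.Properties as AllPairsₚ using ()
open import Data.List.Relation.Unary.Any using (here; there)
open import Data.List.Relation.Unary.Any as Any using ()
open import Data.List.Relation.Unary.Unique.Propositional using (Unique)
open import Data.List.Relation.Unary.Unique.Propositional.Properties as Uniqueₚ using ()
open import Data.Nat using (ℕ; zero; suc; _+_; _∸_; _≤_; z≤n; s≤s; _≡ᵇ_; _<ᵇ_)
open import Data.Nat.Properties as ℕₚ using (+-0-commutativeMonoid)
open import Data.Product using (Σ; ∃-syntax; _×_; _,_; proj₁)
open import Data.Product.Properties using (,-injectiveʳ)
open import Data.Vec as Vec using (Vec; []; _∷_; lookup; tabulate)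
open import Data.Vec.Properties as Vecₚ using (lookup∘tabulate; tabulate∘lookup; tabulate-cong; tabulate-∘; lookup-map)
open import Data.Vec.Relation.Unary.All using (All; []; _∷_)
open import Data.Vec.Relation.Unary.All.Properties as VecAllₚ using ()
open import Function using (_∘_)
open import Function.Bundles using (_⇔_; mk⇔; Equivalence)
open import Function.Properties.Equivalence as ⇔ using ()
open import Relation.Binary.PropositionalEquality
open import Relation.Nullary using (does; contradiction)
open import Relation.Nullary.Decidable using (T?)
open import Algebra.Properties.CommutativeMonoid.Sum +-0-commutativeMonoid using (sum; sum-permute; sum-cong-≋)

private variable
  n j : ℕ

indicator : ℕ → ℕ → ℕ
indicator c x = if x ≡ᵇ c then 1 else 0

countVal≡sum : ∀ c (v : Vec ℕ n) → countVal c v ≡ sum (indicator c ∘ lookup v)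
countVal≡sum c [] = refl
countVal≡sum c (x ∷ v) = cong (_+_ (indicator c x)) (countVal≡sum c v)

countVal-tabulate : ∀ c {f : Fin n → ℕ} {v : Vec ℕ n} →
                    (∀ i → indicator c (f i) ≡ indicator c (lookup v i)) →
                    countVal c (tabulate f) ≡ countVal c v
countVal-tabulate c {v = []} eq = refl
countVal-tabulate c {v = x ∷ v} eq = cong₂ _+_ (eq fzero) (countVal-tabulate c {v = v} (eq ∘ fsuc))

countVal+countVal≤length : ∀ {c d} → c ≢ d → (v : Vec ℕ n) → countVal c v + countVal d v ≤ n
countVal+countVal≤length c≢d [] = z≤n
countVal+countVal≤length {n = suc n} {c} {d} c≢d (x ∷ v)
  with ih ← countVal+countVal≤length c≢d v | x ≡ᵇ c in x≡ᵇc | x ≡ᵇ d in x≡ᵇd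
... | false | false = ℕₚ.m≤n⇒m≤1+n ih
... | true  | false = s≤s ih
... | false | true  = subst (_≤ suc n) (sym (ℕₚ.+-suc (countVal c v) (countVal d v))) (s≤s ih)
... | true  | true  = contradiction (trans (sym (≡ᵇ-true⇒≡ x≡ᵇc)) (≡ᵇ-true⇒≡ x≡ᵇd)) c≢d
  where
  ≡ᵇ-true⇒≡ : ∀ {y} → (x ≡ᵇ y) ≡ true → x ≡ y
  ≡ᵇ-true⇒≡ {y} eq = ℕₚ.≡ᵇ⇒≡ x y (subst T (sym eq) _)

twos+ones≤length : (v : Vec ℕ n) → countVal 2 v + countVal 1 v ≤ n
twos+ones≤length = countVal+countVal≤length (λ ())

permute : Permutation′ n → Vec ℕ n → Vec ℕ n
permute σ v = tabulate (lookup v ∘ (σ ⟨$⟩ˡ_))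

countVal-permute : ∀ c (σ : Permutation′ n) (v : Vec ℕ n) → countVal c (permute σ v) ≡ countVal c v
countVal-permute c σ v = begin
  countVal c (permute σ v)      ≡⟨ countVal≡sum c (permute σ v) ⟩
  sum (h ∘ lookup (permute σ v)) ≡⟨ sum-cong-≋ (cong h ∘ lookup∘tabulate (lookup v ∘ σˡ)) ⟩
  sum (h ∘ lookup v ∘ σˡ)        ≡⟨ sum-permute (h ∘ lookup v ∘ σˡ) σ ⟩
  sum (h ∘ lookup v ∘ σˡ ∘ σʳ)   ≡⟨ sum-cong-≋ {x = h ∘ lookup v ∘ σˡ ∘ σʳ} (λ i → cong (h ∘ lookup v) (inverseˡ σ)) ⟩
  sum (h ∘ lookup v)             ≡⟨ countVal≡sum c v ⟨
  countVal c v                   ∎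
  where
  open ≡-Reasoning
  h = indicator c
  σˡ = σ ⟨$⟩ˡ_
  σʳ = σ ⟨$⟩ʳ_

All-tabulate : {P : ℕ → Set} {f : Fin n → ℕ} → (∀ i → P (f i)) → All P (tabulate f)
All-tabulate {n = zero} p = []
All-tabulate {n = suc n} p = p fzero ∷ All-tabulate (p ∘ fsuc)

+m-+n≡+[m∸n] : ∀ {m n} → n ≤ m → + m - + n ≡ + (m ∸ n)
+m-+n≡+[m∸n] {m} {n} n≤m = trans (m-n≡m⊖n m n) (⊖-≥ n≤m)

x₀²·x^ : Vec ℕ n → Mono n
x₀²·x^ v = + 2 , Vec.map +_ v

permAct-x₀²·x^ : ∀ (σ : Permutation′ n) v → permAct σ (x₀²·x^ v) ≡ x₀²·x^ (permute σ v)
permAct-x₀²·x^ σ v = cong (+ 2 ,_) (begin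
  tabulate (λ i → lookup (Vec.map +_ v) (σ ⟨$⟩ˡ i)) ≡⟨ tabulate-cong (λ i → lookup-map (σ ⟨$⟩ˡ i) +_ v) ⟩
  tabulate (+_ ∘ lookup v ∘ (σ ⟨$⟩ˡ_))               ≡⟨ tabulate-∘ +_ (lookup v ∘ (σ ⟨$⟩ˡ_)) ⟩
  Vec.map +_ (permute σ v)                           ∎)
  where open ≡-Reasoning

reflectAt : Fin n → Vec ℕ n → Vec ℕ n
reflectAt i v = tabulate (λ k → if does (k ≟ i) then 2 ∸ lookup v k else lookup v k)

tauAct-x₀²·x^ : ∀ i {v : Vec ℕ n} → All (_≤ 2) v → tauAct i (x₀²·x^ v) ≡ x₀²·x^ (reflectAt i v)
tauAct-x₀²·x^ i {v} v≤2 = cong (+ 2 ,_) (trans (tabulate-cong entry) (tabulate-∘ +_ _))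
  where
  entry : ∀ k → (if does (k ≟ i) then + 2 - lookup (Vec.map +_ v) k else lookup (Vec.map +_ v) k)
              ≡ + (if does (k ≟ i) then 2 ∸ lookup v k else lookup v k)
  entry k rewrite lookup-map k +_ v with does (k ≟ i)
  ... | true  = +m-+n≡+[m∸n] (VecAllₚ.lookup⁺ v≤2 k)
  ... | false = refl

Admissible : ℕ → Vec ℕ n → Set
Admissible j v = All (_≤ 2) v × countVal 1 v ≡ j

Admissible-permute : ∀ (σ : Permutation′ n) {v} → Admissible j v → Admissible j (permute σ v)
Admissible-permute σ {v} (v≤2 , ones) =
  All-tabulate (VecAllₚ.lookup⁺ v≤2 ∘ (σ ⟨$⟩ˡ_)) , trans (countVal-permute 1 σ v) ones

indicator1-2∸ : ∀ {x} → x ≤ 2 → indicator 1 (2 ∸ x) ≡ indicator 1 x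
indicator1-2∸ z≤n = refl
indicator1-2∸ (s≤s z≤n) = refl
indicator1-2∸ (s≤s (s≤s z≤n)) = refl

Admissible-reflectAt : ∀ i {v : Vec ℕ n} → Admissible j v → Admissible j (reflectAt i v)
Admissible-reflectAt i {v} (v≤2 , ones) = All-tabulate entry≤2 , trans (countVal-tabulate 1 {v = v} sameIndicator) ones
  where
  entry≤2 : ∀ k → (if does (k ≟ i) then 2 ∸ lookup v k else lookup v k) ≤ 2
  entry≤2 k with does (k ≟ i)
  ... | true  = ℕₚ.m∸n≤m 2 (lookup v k)
  ... | false = VecAllₚ.lookup⁺ v≤2 k
  sameIndicator : ∀ k → indicator 1 (if does (k ≟ i) then 2 ∸ lookup v k else lookup v k)
                      ≡ indicator 1 (lookup v k)
  sameIndicator k with does (k ≟ i)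
  ... | true  = indicator1-2∸ (VecAllₚ.lookup⁺ v≤2 k)
  ... | false = refl

AdmissibleMono : ℕ → Mono n → Set
AdmissibleMono j m = ∃[ v ] Admissible j v × m ≡ x₀²·x^ v

Step-AdmissibleMono : ∀ {m m' : Mono n} → Step m m' → AdmissibleMono j m → AdmissibleMono j m'
Step-AdmissibleMono (perm σ _) (v , adm , refl) = permute σ v , Admissible-permute σ adm , permAct-x₀²·x^ σ v
Step-AdmissibleMono (tau i _) (v , adm , refl) = reflectAt i v , Admissible-reflectAt i adm , tauAct-x₀²·x^ i (proj₁ adm)

InOrbit-trans : {f m m' : Mono n} → InOrbit f m → InOrbit m m' → InOrbit f m'
InOrbit-trans p here = p
InOrbit-trans p (next q s) = next (InOrbit-trans p q) s

InOrbit-invariant : (Q : Mono n → Set) → (∀ {m m'} → Step m m' → Q m → Q m') →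
                    {f m : Mono n} → Q f → InOrbit f m → Q m
InOrbit-invariant Q preserved qf here = qf
InOrbit-invariant Q preserved qf (next p s) = preserved s (InOrbit-invariant Q preserved qf p)

consMono : ℤ → Mono n → Mono (suc n)
consMono x (a , e) = a , x ∷ e

InOrbit-cons : ∀ x {f m : Mono n} → InOrbit f m → InOrbit (consMono x f) (consMono x m)
InOrbit-cons x here = here
InOrbit-cons x (next p (perm σ _)) = next (InOrbit-cons x p) (perm (lift₀ σ) _)
InOrbit-cons x (next p (tau i _))  = next (InOrbit-cons x p) (tau (fsuc i) _)

infix 4 _⇝_
_⇝_ : Vec ℕ n → Vec ℕ n → Set
v ⇝ w = InOrbit (x₀²·x^ v) (x₀²·x^ w)

⇝-trans : {u v w : Vec ℕ n} → u ⇝ v → v ⇝ w → u ⇝ w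
⇝-trans = InOrbit-trans

⇝-cons : ∀ x {v w : Vec ℕ n} → v ⇝ w → x ∷ v ⇝ x ∷ w
⇝-cons x = InOrbit-cons (+ x)

⇝-swap : ∀ x y (v : Vec ℕ n) → x ∷ y ∷ v ⇝ y ∷ x ∷ v
⇝-swap x y v = subst (InOrbit _) (cong (λ e → + 2 , + y ∷ + x ∷ e) (tabulate∘lookup (Vec.map +_ v)))
  (next here (perm (transpose fzero (fsuc fzero)) _))

⇝-reflectHead : (v : Vec ℕ n) → 2 ∷ v ⇝ 0 ∷ v
⇝-reflectHead v = subst (InOrbit _) (cong (λ e → + 2 , + 0 ∷ e) (tabulate∘lookup (Vec.map +_ v)))
  (next here (tau fzero _))

twosThenOnes : (n twos : ℕ) → Vec ℕ n
twosThenOnes n twos = tabulate (λ i → if toℕ i <ᵇ twos then 2 else 1)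

startMono≡x₀²·x^twosThenOnes : ∀ n j → startMono n j ≡ x₀²·x^ (twosThenOnes n (n ∸ j))
startMono≡x₀²·x^twosThenOnes n j = cong (+ 2 ,_) (trans
  (tabulate-cong (λ i → sym (if-float +_ (toℕ i <ᵇ n ∸ j))))
  (tabulate-∘ +_ (λ i → if toℕ i <ᵇ n ∸ j then 2 else 1)))

twosThenOnes-suc : ∀ {c} → c ≤ n → twosThenOnes (suc n) (suc n ∸ c) ≡ 2 ∷ twosThenOnes n (n ∸ c)
twosThenOnes-suc {n} c≤n rewrite ℕₚ.+-∸-assoc 1 c≤n = refl

countVal1-twosThenOnes : ∀ n twos → countVal 1 (twosThenOnes n twos) ≡ n ∸ twos
countVal1-twosThenOnes zero    zero       = refl
countVal1-twosThenOnes zero    (suc twos) = refl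
countVal1-twosThenOnes (suc n) zero       = cong suc (countVal1-twosThenOnes n zero)
countVal1-twosThenOnes (suc n) (suc twos) = countVal1-twosThenOnes n twos

Admissible-twosThenOnes : j ≤ n → Admissible j (twosThenOnes n (n ∸ j))
Admissible-twosThenOnes {j} {n} j≤n =
  All-tabulate (λ i → entry≤2 (toℕ i <ᵇ n ∸ j)) , trans (countVal1-twosThenOnes n (n ∸ j)) (ℕₚ.m∸[m∸n]≡n j≤n)
  where
  entry≤2 : ∀ b → (if b then 2 else 1) ≤ 2
  entry≤2 true  = ℕₚ.≤-refl
  entry≤2 false = s≤s z≤n

twosThenOnes-⇝-1∷ : ∀ {twos} → twos ≤ n → twosThenOnes (suc n) twos ⇝ 1 ∷ twosThenOnes n twos
twosThenOnes-⇝-1∷ z≤n = here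
twosThenOnes-⇝-1∷ {suc n} {suc twos} (s≤s twos≤n) =
  ⇝-trans (⇝-cons 2 (twosThenOnes-⇝-1∷ twos≤n)) (⇝-swap 2 1 (twosThenOnes n twos))

twosThenOnes-⇝ : {v : Vec ℕ n} → All (_≤ 2) v → twosThenOnes n (n ∸ countVal 1 v) ⇝ v
twosThenOnes-⇝ [] = here
twosThenOnes-⇝ {suc n} {x ∷ v} (x≤2 ∷ v≤2)
  with ih ← twosThenOnes-⇝ v≤2 | ones≤n ← ℕₚ.m+n≤o⇒n≤o (countVal 2 v) (twos+ones≤length v) | x≤2
... | z≤n           = subst (_⇝ 0 ∷ v) (sym (twosThenOnes-suc ones≤n)) (⇝-trans (⇝-reflectHead _) (⇝-cons 0 ih))
... | s≤s z≤n       = ⇝-trans (twosThenOnes-⇝-1∷ (ℕₚ.m∸n≤m n (countVal 1 v))) (⇝-cons 1 ih)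
... | s≤s (s≤s z≤n) = subst (_⇝ 2 ∷ v) (sym (twosThenOnes-suc ones≤n)) (⇝-cons 2 ih)

InOrbit-start⇔AdmissibleMono : j ≤ n → ∀ m → InOrbit (startMono n j) m ⇔ AdmissibleMono j m
InOrbit-start⇔AdmissibleMono {j} {n} j≤n m = mk⇔
  (InOrbit-invariant (AdmissibleMono j) Step-AdmissibleMono
    (twosThenOnes n (n ∸ j) , Admissible-twosThenOnes j≤n , startMono≡x₀²·x^twosThenOnes n j))
  λ { (v , (v≤2 , refl) , refl) →
      subst (λ f → InOrbit f (x₀²·x^ v)) (sym (startMono≡x₀²·x^twosThenOnes n j)) (twosThenOnes-⇝ v≤2) }

Unique-concatMap : {A B : Set} {f : A → List B} {xs : List A} → Unique xs → (∀ x → Unique (f x)) →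
                   (∀ {x y b} → b ∈ f x → b ∈ f y → x ≡ y) → Unique (concatMap f xs)
Unique-concatMap xs! f! separated = Uniqueₚ.concat⁺
  (ListAllₚ.map⁺ (ListAll.universal f! _))
  (AllPairsₚ.map⁺ (AllPairs.map (λ x≢y {b} (b∈fx , b∈fy) → x≢y (separated b∈fx b∈fy)) xs!))

digitExtensions : Vec ℕ n → List (Vec ℕ (suc n))
digitExtensions v = List.map (_∷ v) (0 ∷ 1 ∷ 2 ∷ [])

∈-allVecs012⁺ : {v : Vec ℕ n} → All (_≤ 2) v → v ∈ allVecs012 n
∈-allVecs012⁺ [] = here refl
∈-allVecs012⁺ {suc n} {x ∷ v} (x≤2 ∷ v≤2) =
  ∈-concatMap⁺ digitExtensions {xs = allVecs012 n} (Any.map (λ { refl → ∈-digitExtensions x≤2 }) (∈-allVecs012⁺ v≤2))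
  where
  ∈-digitExtensions : x ≤ 2 → x ∷ v ∈ digitExtensions v
  ∈-digitExtensions z≤n = here refl
  ∈-digitExtensions (s≤s z≤n) = there (here refl)
  ∈-digitExtensions (s≤s (s≤s z≤n)) = there (there (here refl))

∈-allVecs012⁻ : {v : Vec ℕ n} → v ∈ allVecs012 n → All (_≤ 2) v
∈-allVecs012⁻ {zero} {[]} _ = []
∈-allVecs012⁻ {suc n} v∈ with find (∈-concatMap⁻ digitExtensions {xs = allVecs012 n} v∈)
... | w , w∈ , here refl                 = z≤n ∷ ∈-allVecs012⁻ w∈
... | w , w∈ , there (here refl)         = s≤s z≤n ∷ ∈-allVecs012⁻ w∈
... | w , w∈ , there (there (here refl)) = s≤s (s≤s z≤n) ∷ ∈-allVecs012⁻ w∈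

allVecs012-unique : ∀ n → Unique (allVecs012 n)
allVecs012-unique zero = ListAll.[] AllPairs.∷ AllPairs.[]
allVecs012-unique (suc n) = Unique-concatMap (allVecs012-unique n)
  (λ v → Uniqueₚ.map⁺ (Vecₚ.∷-injectiveˡ {xs = v} {ys = v}) (Uniqueₚ.upTo⁺ 3))
  (λ b∈x b∈y → trans (sym (tail∈digitExtensions b∈x)) (tail∈digitExtensions b∈y))
  where
  tail∈digitExtensions : ∀ {v} {b : Vec ℕ (suc n)} → b ∈ digitExtensions v → Vec.tail b ≡ v
  tail∈digitExtensions (here refl) = refl
  tail∈digitExtensions (there (here refl)) = refl
  tail∈digitExtensions (there (there (here refl))) = refl

map+-injective : {v w : Vec ℕ n} → Vec.map +_ v ≡ Vec.map +_ w → v ≡ w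
map+-injective {v = []} {[]} _ = refl
map+-injective {v = x ∷ v} {y ∷ w} eq =
  cong₂ _∷_ (+-injective (Vecₚ.∷-injectiveˡ eq)) (map+-injective (Vecₚ.∷-injectiveʳ eq))

x₀²·x^-injective : {v w : Vec ℕ n} → x₀²·x^ v ≡ x₀²·x^ w → v ≡ w
x₀²·x^-injective = map+-injective ∘ ,-injectiveʳ

hasCounts : ℕ → ℕ → Vec ℕ n → Bool
hasCounts k j e = (countVal 2 e ≡ᵇ k) ∧ (countVal 1 e ≡ᵇ j)

∈-frakS⁻ : ∀ {k} {e : Vec ℤ n} → e ∈ frakS n k j →
           ∃[ v ] (All (_≤ 2) v × countVal 2 v ≡ k × countVal 1 v ≡ j) × e ≡ Vec.map +_ v
∈-frakS⁻ {n} {j} {k} e∈ with ∈-map⁻ (Vec.map (+_)) e∈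
... | v , v∈ , refl with ∈-filter⁻ (T? ∘ hasCounts k j) {xs = allVecs012 n} v∈
... | v∈all , counts with Equivalence.to T-∧ counts
... | twos , ones = v , (∈-allVecs012⁻ v∈all , ℕₚ.≡ᵇ⇒≡ _ _ twos , ℕₚ.≡ᵇ⇒≡ _ _ ones) , refl

∈-frakS⁺ : {v : Vec ℕ n} → All (_≤ 2) v → Vec.map +_ v ∈ frakS n (countVal 2 v) (countVal 1 v)
∈-frakS⁺ {v = v} v≤2 = ∈-map⁺ (Vec.map (+_)) (∈-filter⁺ (T? ∘ hasCounts (countVal 2 v) (countVal 1 v)) (∈-allVecs012⁺ v≤2)
  (Equivalence.from T-∧ (ℕₚ.≡⇒≡ᵇ (countVal 2 v) _ refl , ℕₚ.≡⇒≡ᵇ (countVal 1 v) _ refl)))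

rhsLayer : (n j k : ℕ) → List (Mono n)
rhsLayer n j k = List.map (λ e → (+ 2 , e)) (frakS n k j)

∈-rhs⇔AdmissibleMono : ∀ m → m ∈ rhs n j ⇔ AdmissibleMono j m
∈-rhs⇔AdmissibleMono {n} {j} m = mk⇔ to from
  where
  to : m ∈ rhs n j → AdmissibleMono j m
  to m∈ with find (∈-concatMap⁻ (rhsLayer n j) {xs = upTo (suc (n ∸ j))} m∈)
  ... | k , _ , m∈layer with ∈-map⁻ (λ e → (+ 2 , e)) m∈layer
  ... | e , e∈ , refl with ∈-frakS⁻ e∈
  ... | v , (v≤2 , _ , ones) , refl = v , (v≤2 , ones) , refl
  from : AdmissibleMono j m → m ∈ rhs n j
  from (v , (v≤2 , refl) , refl) = ∈-concatMap⁺ (rhsLayer n j) {xs = upTo (suc (n ∸ j))}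
    (Any.map (λ { refl → ∈-map⁺ (λ e → (+ 2 , e)) (∈-frakS⁺ v≤2) }) (∈-upTo⁺ (s≤s twos≤n∸j)))
    where
    twos≤n∸j : countVal 2 v ≤ n ∸ countVal 1 v
    twos≤n∸j = ℕₚ.m+n≤o⇒m≤o∸n (countVal 2 v) (twos+ones≤length v)

rhs-unique : ∀ n j → Unique (rhs n j)
rhs-unique n j = Unique-concatMap (Uniqueₚ.upTo⁺ (suc (n ∸ j))) layer-unique separated
  where
  layer-unique : ∀ k → Unique (rhsLayer n j k)
  layer-unique k = Uniqueₚ.map⁺ ,-injectiveʳ
    (Uniqueₚ.map⁺ map+-injective (Uniqueₚ.filter⁺ (T? ∘ hasCounts k j) (allVecs012-unique n)))
  separated : ∀ {k k' m} → m ∈ rhsLayer n j k → m ∈ rhsLayer n j k' → k ≡ k'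
  separated m∈k m∈k' with ∈-map⁻ (λ e → (+ 2 , e)) m∈k | ∈-map⁻ (λ e → (+ 2 , e)) m∈k'
  ... | e , e∈ , refl | e' , e'∈ , eq with ∈-frakS⁻ e∈ | ∈-frakS⁻ e'∈
  ... | v , (_ , twos , _) , refl | v' , (_ , twos' , _) , refl =
    trans (sym twos) (trans (cong (countVal 2) (x₀²·x^-injective eq)) twos')

IsSymW-↭ : ∀ {f : Mono n} {L L'} → IsSymW f L → IsSymW f L' → L ↭ L'
IsSymW-↭ (L! , ∈L) (L'! , ∈L') = ∼bag⇒↭ (unique∧set⇒bag L! L'! (λ {m} → ⇔.trans (∈L m) (⇔.sym (∈L' m))))

rhs-IsSymW : j ≤ n → IsSymW (startMono n j) (rhs n j)
rhs-IsSymW {j} {n} j≤n = rhs-unique n j , λ m →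
  ⇔.trans (∈-rhs⇔AdmissibleMono m) (⇔.sym (InOrbit-start⇔AdmissibleMono j≤n m))

mainTheorem2 : (n j : ℕ) → 1 ≤ n → j ≤ n →
    Σ (List (Mono n)) (λ L → IsSymW (startMono n j) L)
    × ((L : List (Mono n)) → IsSymW (startMono n j) L → L ↭ rhs n j)
mainTheorem2 n j _ j≤n = (rhs n j , rhs-IsSymW j≤n) , λ L L-IsSymW → IsSymW-↭ L-IsSymW (rhs-IsSymW j≤n)
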